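{- Let $m$ be odd and let $f:\mathbb{Z}_m\to\{\pm1,\pm\mathrm{i}\}$ be an OQS. Then $R_f(w)\in\{1,-1\}$ for all $1\le w\le m-1$.
   Context: $\mathrm{i}=\sqrt{ -1}$. $R_f(w)=\sum_{k\in\mathbb{Z}_m}f(k)\overline{f(k+w)}$. A quaternary sequence $f$ of odd length $m$ is an OQS if $|R_f(w)|=1$ for all $1\le w\le m-1$. -}

module Defs where

open import Data.Nat as ℕ using (ℕ; NonZero)
open import Data.Nat.DivMod using (_%_)
open import Data.Integer as ℤ using (ℤ; +_; -[1+_])
open import Data.Fin as Fin using (Fin; toℕ; fromℕ<)
open import Data.Nat.DivMod using (m%n<n)
open import Relation.Binary.PropositionalEquality using (_≡_)

record ℤ[i] : Set where
  constructor _+_i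
  field
    re : ℤ
    im : ℤ
open ℤ[i] public

0ᵍ : ℤ[i]
0ᵍ = (+ 0) + (+ 0) i

1ᵍ : ℤ[i]
1ᵍ = (+ 1) + (+ 0) i

-1ᵍ : ℤ[i]
-1ᵍ = (ℤ.- (+ 1)) + (+ 0) i

infixl 6 _+ᵍ_
infixl 7 _*ᵍ_

_+ᵍ_ : ℤ[i] → ℤ[i] → ℤ[i]
(a + b i) +ᵍ (c + d i) = (a ℤ.+ c) + (b ℤ.+ d) i

_*ᵍ_ : ℤ[i] → ℤ[i] → ℤ[i]
(a + b i) *ᵍ (c + d i) = (a ℤ.* c ℤ.- b ℤ.* d) + (a ℤ.* d ℤ.+ b ℤ.* c) i

conj : ℤ[i] → ℤ[i]
conj (a + b i) = a + (ℤ.- b) i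

normᵍ : ℤ[i] → ℤ
normᵍ (a + b i) = a ℤ.* a ℤ.+ b ℤ.* b

data Quaternary : Set where
  q1 qi q-1 q-i : Quaternary

val : Quaternary → ℤ[i]
val q1  = (+ 1) + (+ 0) i
val qi  = (+ 0) + (+ 1) i
val q-1 = (ℤ.- (+ 1)) + (+ 0) i
val q-i = (+ 0) + (ℤ.- (+ 1)) i

Σᵍ : (m : ℕ) → (Fin m → ℤ[i]) → ℤ[i]
Σᵍ ℕ.zero    g = 0ᵍ
Σᵍ (ℕ.suc m) g = g Fin.zero +ᵍ Σᵍ m (λ k → g (Fin.suc k))

_⊕_ : {m : ℕ} → Fin m → ℕ → Fin m
_⊕_ {ℕ.zero}  ()
_⊕_ {ℕ.suc m} k w = fromℕ< (m%n<n (toℕ k ℕ.+ w) (ℕ.suc m))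

R : {m : ℕ} → (Fin m → Quaternary) → ℕ → ℤ[i]
R {m} f w = Σᵍ m (λ k → val (f k) *ᵍ conj (val (f (k ⊕ w))))

IsOQS : (m : ℕ) → (Fin m → Quaternary) → Set
IsOQS m f = ∀ (w : ℕ) → 1 ℕ.≤ w → w ℕ.≤ m ℕ.∸ 1 → normᵍ (R f w) ≡ + 1

module Submission where

-- Each product f(k)·conj(f(k+w)) is a power of i, whose imaginary part is odd
-- exactly when one of f(k), f(k+w) is imaginary.  Hence Im R_f(w) ≡ N − N ≡ 0
-- (mod 2), where N counts the imaginary values of f, since k ↦ k+w permutes ℤ_m.
-- A Gaussian integer of norm 1 with even imaginary part is ±1.

open import Defs
open import Data.Nat using (ℕ; _≤_; _∸_)
open import Data.Nat.DivMod using (_%_)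
open import Data.Fin using (Fin)
open import Data.Sum using (_⊎_)
open import Relation.Binary.PropositionalEquality using (_≡_)

open import Algebra.Bundles using (CommutativeMonoid; AbelianGroup)
import Algebra.Properties.CommutativeMonoid.Sum as CommutativeMonoidSum
open import Data.Empty using (⊥-elim)
open import Data.Fin using (zero; suc; toℕ; fromℕ; inject₁)
open import Data.Fin.Properties using (toℕ-injective; toℕ-fromℕ<; toℕ-fromℕ; toℕ-inject₁; toℕ<n)
open import Data.Integer as ℤ using (ℤ; +_; _+_; +[1+_]; -[1+_])
import Data.Integer.Properties as ZP
open import Algebra.Properties.Group (AbelianGroup.group ZP.+-0-abelianGroup) using (∙-cancelʳ)
open import Data.Nat as ℕ using ()
import Data.Nat.Properties as NP
open import Data.Nat.DivMod using (m%n<n; m<n⇒m%n≡m; n%n≡0; m%n%n≡m%n; %-distribˡ-+)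
open import Data.Product using (_×_; _,_)
open import Data.Sum as Sum using (inj₁; inj₂)
open import Data.Vec.Functional using (Vector)
open import Function using (_∘_)
open import Relation.Binary.PropositionalEquality
  using (_≢_; refl; sym; trans; cong; cong₂; module ≡-Reasoning)

toℕ-⊕ : ∀ {n} (k : Fin (ℕ.suc n)) w → toℕ (k ⊕ w) ≡ (toℕ k ℕ.+ w) % ℕ.suc n
toℕ-⊕ {n} k w = toℕ-fromℕ< (m%n<n (toℕ k ℕ.+ w) (ℕ.suc n))

⊕-identityʳ : ∀ {m} (k : Fin m) → k ⊕ 0 ≡ k
⊕-identityʳ {ℕ.suc n} k = toℕ-injective (begin
  toℕ (k ⊕ 0)              ≡⟨ toℕ-⊕ k 0 ⟩
  (toℕ k ℕ.+ 0) % ℕ.suc n  ≡⟨ cong (_% ℕ.suc n) (NP.+-identityʳ (toℕ k)) ⟩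
  toℕ k % ℕ.suc n          ≡⟨ m<n⇒m%n≡m (toℕ<n k) ⟩
  toℕ k                    ∎)
  where open ≡-Reasoning

⊕-assoc : ∀ {m} (k : Fin m) u v → (k ⊕ u) ⊕ v ≡ k ⊕ (u ℕ.+ v)
⊕-assoc {ℕ.suc n} k u v = toℕ-injective (begin
  toℕ ((k ⊕ u) ⊕ v)                       ≡⟨ toℕ-⊕ (k ⊕ u) v ⟩
  (toℕ (k ⊕ u) ℕ.+ v) % d                 ≡⟨ cong (λ x → (x ℕ.+ v) % d) (toℕ-⊕ k u) ⟩
  ((t ℕ.+ u) % d ℕ.+ v) % d               ≡⟨ %-distribˡ-+ ((t ℕ.+ u) % d) v d ⟩
  ((t ℕ.+ u) % d % d ℕ.+ v % d) % d       ≡⟨ cong (λ x → (x ℕ.+ v % d) % d) (m%n%n≡m%n (t ℕ.+ u) d) ⟩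
  ((t ℕ.+ u) % d ℕ.+ v % d) % d           ≡⟨ %-distribˡ-+ (t ℕ.+ u) v d ⟨
  (t ℕ.+ u ℕ.+ v) % d                     ≡⟨ cong (_% d) (NP.+-assoc t u v) ⟩
  (t ℕ.+ (u ℕ.+ v)) % d                   ≡⟨ toℕ-⊕ k (u ℕ.+ v) ⟨
  toℕ (k ⊕ (u ℕ.+ v))                     ∎)
  where
  open ≡-Reasoning
  t = toℕ k
  d = ℕ.suc n

inject₁-⊕-1 : ∀ {n} (j : Fin n) → inject₁ j ⊕ 1 ≡ suc j
inject₁-⊕-1 {n} j = toℕ-injective (begin
  toℕ (inject₁ j ⊕ 1)              ≡⟨ toℕ-⊕ (inject₁ j) 1 ⟩
  (toℕ (inject₁ j) ℕ.+ 1) % ℕ.suc n ≡⟨ cong (λ x → (x ℕ.+ 1) % ℕ.suc n) (toℕ-inject₁ j) ⟩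
  (toℕ j ℕ.+ 1) % ℕ.suc n          ≡⟨ cong (_% ℕ.suc n) (NP.+-comm (toℕ j) 1) ⟩
  ℕ.suc (toℕ j) % ℕ.suc n          ≡⟨ m<n⇒m%n≡m (ℕ.s≤s (toℕ<n j)) ⟩
  ℕ.suc (toℕ j)                    ∎)
  where open ≡-Reasoning

fromℕ-⊕-1 : ∀ n → fromℕ n ⊕ 1 ≡ zero
fromℕ-⊕-1 n = toℕ-injective (begin
  toℕ (fromℕ n ⊕ 1)              ≡⟨ toℕ-⊕ (fromℕ n) 1 ⟩
  (toℕ (fromℕ n) ℕ.+ 1) % ℕ.suc n ≡⟨ cong (λ x → (x ℕ.+ 1) % ℕ.suc n) (toℕ-fromℕ n) ⟩
  (n ℕ.+ 1) % ℕ.suc n            ≡⟨ cong (_% ℕ.suc n) (NP.+-comm n 1) ⟩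
  ℕ.suc n % ℕ.suc n              ≡⟨ n%n≡0 (ℕ.suc n) ⟩
  0                              ∎)
  where open ≡-Reasoning

module _ {c ℓ} (M : CommutativeMonoid c ℓ) where
  open CommutativeMonoid M using (Carrier; _≈_; _∙_; comm; setoid)
    renaming (refl to ≈-refl; reflexive to ≈-reflexive)
  open CommutativeMonoidSum M using (sum; sum-init-last; sum-cong-≗)
  open import Relation.Binary.Reasoning.Setoid setoid

  sum-rotate-1 : ∀ {m} (g : Vector Carrier m) → sum (g ∘ (_⊕ 1)) ≈ sum g
  sum-rotate-1 {ℕ.zero}  g = ≈-refl
  sum-rotate-1 {ℕ.suc n} g = begin
    sum (g ∘ (_⊕ 1))                                 ≈⟨ sum-init-last (g ∘ (_⊕ 1)) ⟩
    sum (g ∘ (_⊕ 1) ∘ inject₁) ∙ g (fromℕ n ⊕ 1)    ≡⟨ cong₂ _∙_ (sum-cong-≗ (cong g ∘ inject₁-⊕-1))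
                                                                 (cong g (fromℕ-⊕-1 n)) ⟩
    sum (g ∘ suc) ∙ g zero                           ≈⟨ comm _ _ ⟩
    sum g                                            ∎

  sum-rotate : ∀ {m} (g : Vector Carrier m) w → sum (g ∘ (_⊕ w)) ≈ sum g
  sum-rotate g ℕ.zero    = ≈-reflexive (sum-cong-≗ (cong g ∘ ⊕-identityʳ))
  sum-rotate g (ℕ.suc w) = begin
    sum (g ∘ (_⊕ ℕ.suc w))          ≡⟨ sum-cong-≗ (λ k → cong g (⊕-assoc k 1 w)) ⟨
    sum (g ∘ (_⊕ w) ∘ (_⊕ 1))       ≈⟨ sum-rotate-1 (g ∘ (_⊕ w)) ⟩
    sum (g ∘ (_⊕ w))                ≈⟨ sum-rotate g w ⟩
    sum g                           ∎

open CommutativeMonoidSum ZP.+-0-commutativeMonoid using (sum; ∑-distrib-+; sum-cong-≗)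

im-Σᵍ : ∀ m (h : Fin m → ℤ[i]) → im (Σᵍ m h) ≡ sum (im ∘ h)
im-Σᵍ ℕ.zero    h = refl
im-Σᵍ (ℕ.suc m) h = cong (_+_ (im (h zero))) (im-Σᵍ m (h ∘ suc))

imaginaryIndicator : Quaternary → ℤ
imaginaryIndicator q1  = + 0
imaginaryIndicator qi  = + 1
imaginaryIndicator q-1 = + 0
imaginaryIndicator q-i = + 1

halfImDefect : Quaternary → Quaternary → ℤ
halfImDefect q1  q-i = + 1
halfImDefect qi  q-1 = -[1+ 0 ]
halfImDefect q-1 qi  = + 1
halfImDefect q-i q1  = -[1+ 0 ]
halfImDefect _   _   = + 0

-- Modulo 2 this says  Im (a · conj b) ≡ χ a − χ b  with χ = imaginaryIndicator.
im-val*conj-val : ∀ a b → im (val a *ᵍ conj (val b)) + imaginaryIndicator b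
                          ≡ imaginaryIndicator a + (halfImDefect a b + halfImDefect a b)
im-val*conj-val q1  q1  = refl
im-val*conj-val q1  qi  = refl
im-val*conj-val q1  q-1 = refl
im-val*conj-val q1  q-i = refl
im-val*conj-val qi  q1  = refl
im-val*conj-val qi  qi  = refl
im-val*conj-val qi  q-1 = refl
im-val*conj-val qi  q-i = refl
im-val*conj-val q-1 q1  = refl
im-val*conj-val q-1 qi  = refl
im-val*conj-val q-1 q-1 = refl
im-val*conj-val q-1 q-i = refl
im-val*conj-val q-i q1  = refl
im-val*conj-val q-i qi  = refl
im-val*conj-val q-i q-1 = refl
im-val*conj-val q-i q-i = refl

halfImR : ∀ {m} → (Fin m → Quaternary) → ℕ → ℤ
halfImR f w = sum (λ k → halfImDefect (f k) (f (k ⊕ w)))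

im-R≡halfImR+halfImR : ∀ {m} (f : Fin m → Quaternary) w → im (R f w) ≡ halfImR f w + halfImR f w
im-R≡halfImR+halfImR {m} f w = ∙-cancelʳ (sum χf) (im (R f w)) (D + D) (begin
  im (R f w) + sum χf                    ≡⟨ cong₂ _+_ (im-Σᵍ m term) (sym (sum-rotate ZP.+-0-commutativeMonoid χf w)) ⟩
  sum (im ∘ term) + sum (χf ∘ (_⊕ w))    ≡⟨ ∑-distrib-+ (im ∘ term) (χf ∘ (_⊕ w)) ⟨
  sum (λ k → im (term k) + χf (k ⊕ w))   ≡⟨ sum-cong-≗ (λ k → im-val*conj-val (f k) (f (k ⊕ w))) ⟩
  sum (λ k → χf k + (δ k + δ k))         ≡⟨ ∑-distrib-+ χf (λ k → δ k + δ k) ⟩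
  sum χf + sum (λ k → δ k + δ k)         ≡⟨ cong (_+_ (sum χf)) (∑-distrib-+ δ δ) ⟩
  sum χf + (D + D)                       ≡⟨ ZP.+-comm (sum χf) (D + D) ⟩
  D + D + sum χf                         ∎)
  where
  open ≡-Reasoning
  term : Fin m → ℤ[i]
  term k = val (f k) *ᵍ conj (val (f (k ⊕ w)))
  χf δ : Fin m → ℤ
  χf = imaginaryIndicator ∘ f
  δ k = halfImDefect (f k) (f (k ⊕ w))
  D : ℤ
  D = halfImR f w

i*i≡+∣i∣*∣i∣ : ∀ i → i ℤ.* i ≡ + (ℤ.∣ i ∣ ℕ.* ℤ.∣ i ∣)
i*i≡+∣i∣*∣i∣ (+ n)    = sym (ZP.pos-* n n)
i*i≡+∣i∣*∣i∣ -[1+ n ] = ZP.+◃n≡+n (ℕ.suc n ℕ.* ℕ.suc n)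

normᵍ≡+∣re∣²+∣im∣² : ∀ z → normᵍ z ≡ + (ℤ.∣ re z ∣ ℕ.* ℤ.∣ re z ∣ ℕ.+ ℤ.∣ im z ∣ ℕ.* ℤ.∣ im z ∣)
normᵍ≡+∣re∣²+∣im∣² (a + b i) =
  trans (cong₂ _+_ (i*i≡+∣i∣*∣i∣ a) (i*i≡+∣i∣*∣i∣ b))
        (sym (ZP.pos-+ (ℤ.∣ a ∣ ℕ.* ℤ.∣ a ∣) (ℤ.∣ b ∣ ℕ.* ℤ.∣ b ∣)))

x²+y²≡1 : ∀ x y → x ℕ.* x ℕ.+ y ℕ.* y ≡ 1 → (x ≡ 1 × y ≡ 0) ⊎ (x ≡ 0 × y ≡ 1)
x²+y²≡1 0                 0                 ()
x²+y²≡1 0                 1                 _  = inj₂ (refl , refl)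
x²+y²≡1 0                 (ℕ.suc (ℕ.suc y)) ()
x²+y²≡1 1                 0                 _  = inj₁ (refl , refl)
x²+y²≡1 1                 (ℕ.suc y)         ()
x²+y²≡1 (ℕ.suc (ℕ.suc x)) y                 ()

∣i+i∣≢1 : ∀ i → ℤ.∣ i + i ∣ ≢ 1
∣i+i∣≢1 (+ 0)     ()
∣i+i∣≢1 +[1+ n ]  eq = NP.m+1+n≢0 n (NP.suc-injective eq)
∣i+i∣≢1 -[1+ n ]  ()

∣i∣≡1⇒i≡±1 : ∀ i → ℤ.∣ i ∣ ≡ 1 → i ≡ + 1 ⊎ i ≡ -[1+ 0 ]
∣i∣≡1⇒i≡±1 (+ 1)      _ = inj₁ refl
∣i∣≡1⇒i≡±1 -[1+ 0 ]  _ = inj₂ refl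

normᵍ≡1∧im-even⇒±1 : ∀ z s → normᵍ z ≡ + 1 → im z ≡ s + s → z ≡ 1ᵍ ⊎ z ≡ -1ᵍ
normᵍ≡1∧im-even⇒±1 (a + .(s + s) i) s norm≡1 refl
  with x²+y²≡1 ℤ.∣ a ∣ ℤ.∣ s + s ∣ (ZP.+-injective (trans (sym (normᵍ≡+∣re∣²+∣im∣² (a + (s + s) i))) norm≡1))
... | inj₂ (_ , ∣b∣≡1) = ⊥-elim (∣i+i∣≢1 s ∣b∣≡1)
... | inj₁ (∣a∣≡1 , ∣b∣≡0) =
  Sum.map (λ a≡1 → cong₂ _+_i a≡1 b≡0) (λ a≡-1 → cong₂ _+_i a≡-1 b≡0) (∣i∣≡1⇒i≡±1 a ∣a∣≡1)
  where
  b≡0 : s + s ≡ + 0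
  b≡0 = ZP.∣i∣≡0⇒i≡0 ∣b∣≡0

corollary2 : (m : ℕ) → m % 2 ≡ 1 → (f : Fin m → Quaternary) → IsOQS m f →
    ∀ (w : ℕ) → 1 ≤ w → w ≤ m ∸ 1 → (R f w ≡ 1ᵍ) ⊎ (R f w ≡ -1ᵍ)
corollary2 m _ f isOQS w 1≤w w≤m-1 =
  normᵍ≡1∧im-even⇒±1 (R f w) (halfImR f w) (isOQS w 1≤w w≤m-1) (im-R≡halfImR+halfImR f w)
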